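{- Let $r\geq 1$ be an integer and $X_1,\ldots,X_r$ finite nonempty sets. For any map $f:X_1\times\cdots\times X_r\to[r]$ there is a color $\sigma\in[r]$ such that for every $x_\sigma\in X_\sigma$ there exist elements $x_s\in X_s$, $s\in[r]\setminus\{\sigma\}$, with $f(x_1,\ldots,x_r)=\sigma$.
   Context: $[r]=\{1,\ldots,r\}$. -}

module Defs where

open import Data.Nat using (ℕ; suc)
open import Data.Fin using (Fin)

-- A point of the product X_1 × ⋯ × X_r, where X_i is modelled as Fin (suc (n i))
-- (a finite nonempty set with n i + 1 elements), indices i ∈ Fin r ≅ [r].
Point : (r : ℕ) → (Fin r → ℕ) → Set
Point r n = (i : Fin r) → Fin (suc (n i))

module Submission where

-- Call σ a "winning" colour if every value a of the σ-th coordinate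
-- extends to a point x with x σ = a and f x = σ.  Suppose no colour wins; then for
-- each σ we may choose a value g σ that does not extend.  The point g itself has
-- some colour τ = f g, and it is a point with g τ as τ-th coordinate and colour τ
-- — so g τ does extend, a contradiction.
--
-- To make this constructive, "σ wins" must be decidable, which requires searching
-- the finite product.  Points are functions, so we search instead over tuples,
-- the inductive representation of the product, and note that every point is
-- pointwise reproduced by a tuple.

open import Defs
open import Data.Nat using (ℕ; suc; zero)
open import Data.Fin using (Fin; zero; suc; _≟_)
open import Data.Fin.Properties using (any?; all?; ¬∀⟶∃¬)
open import Data.Product using (Σ; _×_; _,_; proj₁; proj₂)
open import Data.Sum using (_⊎_; inj₁; inj₂)
open import Data.Unit using (⊤; tt)
open import Data.Empty using (⊥-elim)
open import Relation.Nullary using (Dec; yes; no; ¬_)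
open import Relation.Nullary.Decidable using (_×-dec_)
open import Relation.Binary.PropositionalEquality using (_≡_; refl)

-- The product X₁ × ⋯ × X_r as nested pairs; unlike Point it is built by
-- recursion on r, so it can be searched exhaustively.
Tuple : (r : ℕ) → (Fin r → ℕ) → Set
Tuple zero    n = ⊤
Tuple (suc r) n = Fin (suc (n zero)) × Tuple r (λ i → n (suc i))

toPoint : ∀ {r n} → Tuple r n → Point r n
toPoint {suc r} (h , t) zero    = h
toPoint {suc r} (h , t) (suc i) = toPoint t i

fromPoint : ∀ {r n} → Point r n → Tuple r n
fromPoint {zero}  x = tt
fromPoint {suc r} x = x zero , fromPoint (λ i → x (suc i))

toPoint-fromPoint : ∀ {r n} (x : Point r n) (i : Fin r) →
                    toPoint {n = n} (fromPoint x) i ≡ x i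
toPoint-fromPoint {suc r} x zero    = refl
toPoint-fromPoint {suc r} x (suc i) = toPoint-fromPoint (λ j → x (suc j)) i

search : ∀ {r n} (P : Tuple r n → Set) → (∀ t → Dec (P t)) → Dec (Σ (Tuple r n) P)
search {zero} P P? with P? tt
... | yes p = yes (tt , p)
... | no ¬p = no λ { (tt , p) → ¬p p }
search {suc r} P P? with any? (λ h → search (λ t → P (h , t)) (λ t → P? (h , t)))
... | yes (h , t , p) = yes ((h , t) , p)
... | no ¬p           = no λ { ((h , t) , p) → ¬p (h , t , p) }

full-row-or-holes : ∀ {k} {m : Fin k → ℕ} (P : (i : Fin k) → Fin (m i) → Set) →
                    (∀ i a → Dec (P i a)) →
                    (Σ (Fin k) λ i → ∀ a → P i a) ⊎ ((i : Fin k) → Σ (Fin (m i)) λ a → ¬ P i a)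
full-row-or-holes P P? with any? (λ i → all? (P? i))
... | yes full = inj₁ full
... | no ¬full = inj₂ λ i → ¬∀⟶∃¬ _ (P i) (P? i) (λ all → ¬full (i , all))

module _ {r : ℕ} {n : Fin r → ℕ} (f : Point r n → Fin r) where

  -- The value a of coordinate σ extends to a point of colour σ
  -- (witnessed by a tuple, so that it is decidable).
  Extends : (σ : Fin r) → Fin (suc (n σ)) → Set
  Extends σ a = Σ (Tuple r n) λ t → (toPoint t σ ≡ a) × (f (toPoint t) ≡ σ)

  extends? : ∀ σ a → Dec (Extends σ a)
  extends? σ a = search _ (λ t → (toPoint t σ ≟ a) ×-dec (f (toPoint t) ≟ σ))

  -- Diagonal observation: any point x, with colour τ, shows that its own τ-th
  -- coordinate extends.
  diagonal : (x : Point r n) → Extends (f (toPoint (fromPoint x))) (x (f (toPoint (fromPoint x))))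
  diagonal x = fromPoint x , toPoint-fromPoint x _ , refl

lemma30 : (r : ℕ) → (n : Fin (suc r) → ℕ) → (f : Point (suc r) n → Fin (suc r)) →
    Σ (Fin (suc r)) λ σ → (a : Fin (suc (n σ))) →
    Σ (Point (suc r) n) λ x → (x σ ≡ a) × (f x ≡ σ)
lemma30 r n f with full-row-or-holes (Extends f) (extends? f)
... | inj₁ (σ , wins) = σ , λ a → toPoint (proj₁ (wins a)) , proj₂ (wins a)
-- Every colour has a non-extending value g σ; the point g contradicts this.
... | inj₂ holes = ⊥-elim (proj₂ (holes _) (diagonal f g))
  where
  g : Point (suc r) n
  g σ = proj₁ (holes σ)
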